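{- Let $\sigma$ be a signature, $\varphi$ a $\mathcal{CO}_{\sqcup}[\sigma]$- or $\mathcal{COD}[\sigma]$-formula, and $T,S$ two causal teams over $\sigma$ (respectively two generalized causal teams over $\sigma$) with $T\approx S$. Then $T\models\varphi$ iff $S\models\varphi$ (with respect to causal team semantics, respectively generalized causal team semantics).
   Context: Signature $\sigma=(\mathrm{Dom},\mathrm{Ran})$: nonempty finite set of variables, each with a nonempty finite range; $\mathrm{Ran}(\mathbf X)$ is the product of ranges. Assignments $s$ with $s(X)\in\mathrm{Ran}(X)$; $\mathbb A_\sigma$ their set. A system of functions $\mathcal F$ assigns to each $V\in\mathrm{En}(\mathcal F)\subseteq\mathrm{Dom}$ a set $PA_V^{\mathcal F}\subseteq\mathrm{Dom}\setminus\{V\}$ and $\mathcal F_V:\mathrm{Ran}(PA_V^{\mathcal F})\to\mathrm{Ran}(V)$; $\mathbb F_\sigma$ is the set of all such; recursive if the graph with edges $(X,Y)$, $X\in PA_Y^{\mathcal F}$, is acyclic; $s$ compatible with $\mathcal F$ if $s(V)=\mathcal F_V(s(PA_V^{\mathcal F}))$ for $V\in\mathrm{En}(\mathcal F)$. Causal team: $(T^-,\mathcal F)$, $\mathcal F$ recursive, $T^-\subseteq\mathbb A_\sigma$ of compatible assignments; causal subteam: $(S^-,\mathcal F)$ with $S^-\subseteq T^-$. Generalized causal team: a set $T$ of pairs $(s,\mathcal F)$ with $\mathcal F$ recursive and $s$ compatible; subteams are subsets; $T^-=\{s\mid(s,\mathcal F)\in T\}$. $\mathbf X=\mathbf x$: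 conjunction of equations, consistent if no variable gets two distinct values. Intervention (consistent): $\mathcal F_{\mathbf X=\mathbf x}$ = restriction of $\mathcal F$ to $\mathrm{En}(\mathcal F)\setminus\mathbf X$; $s_{\mathbf X=\mathbf x}(X_i)=x_i$, $s_{\mathbf X=\mathbf x}(V)=s(V)$ for $V\notin\mathrm{En}(\mathcal F)\cup\mathbf X$, $s_{\mathbf X=\mathbf x}(V)=\mathcal F_V(s_{\mathbf X=\mathbf x}(PA_V^{\mathcal F}))$ recursively otherwise; $T_{\mathbf X=\mathbf x}=(\{s_{\mathbf X=\mathbf x}\mid s\in T^-\},\mathcal F_{\mathbf X=\mathbf x})$ resp. $\{(s_{\mathbf X=\mathbf x},\mathcal F_{\mathbf X=\mathbf x})\mid(s,\mathcal F)\in T\}$. Languages: $\mathcal{CO}[\sigma]$: $\alpha::=X=x\mid\neg\alpha\mid\alpha\wedge\alpha\mid\alpha\vee\alpha\mid\mathbf X=\mathbf x\ \Box\!\!\rightarrow\alpha$; $\mathcal{CO}_{\sqcup}[\sigma]$ adds $\varphi\sqcup\varphi$; $\mathcal{COD}[\sigma]$ adds dependence atoms $=\!(\mathbf X;Y)$ (negation only on $\mathcal{CO}[\sigma]$-formulas). Causal-team semantics: $T\models X=x$ iff $s(X)=x$ for all $s\in T^-$; $T\models\ =\!(\mathbf X;Y)$ iff for all $s,s'\in T^-$, $s(\mathbf X)=s'(\mathbf X)$ implies $s(Y)=s'(Y)$; $T\models\neg\alpha$ iff $(\{s\},\mathcal F)\not\models\alpha$ for all $s\in T^-$; $\wedge$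 usual; $T\models\varphi\vee\psi$ iff causal subteams $T_1,T_2$ with $T_1^-\cup T_2^-=T^-$, $T_1\models\varphi$, $T_2\models\psi$ exist; $T\models\varphi\sqcup\psi$ iff $T\models\varphi$ or $T\models\psi$; $T\models\mathbf X=\mathbf x\ \Box\!\!\rightarrow\varphi$ iff inconsistent or $T_{\mathbf X=\mathbf x}\models\varphi$. Generalized semantics: same, except $T\models\neg\alpha$ iff $\{(s,\mathcal F)\}\not\models\alpha$ for all $(s,\mathcal F)\in T$, and $T\models\varphi\vee\psi$ iff $T=T_1\cup T_2$ with $T_1\models\varphi$, $T_2\models\psi$. Equivalence: $\mathrm{Cn}(\mathcal F)$ = set of $V\in\mathrm{En}(\mathcal F)$ with $\mathcal F_V$ constant. $\mathcal F_V\sim\mathcal G_V$ iff $\mathcal F_V(\mathbf x\mathbf y)=\mathcal G_V(\mathbf x\mathbf z)$ for all $\mathbf x\in\mathrm{Ran}(PA_V^{\mathcal F}\cap PA_V^{\mathcal G})$, $\mathbf y\in\mathrm{Ran}(PA_V^{\mathcal F}\setminus PA_V^{\mathcal G})$, $\mathbf z\in\mathrm{Ran}(PA_V^{\mathcal G}\setminus PA_V^{\mathcal F})$; $\mathcal F\sim\mathcal G$ iff $\mathrm{En}(\mathcal F)\setminus\mathrm{Cn}(\mathcal F)=\mathrm{En}(\mathcal G)\setminus\mathrm{Cn}(\mathcal G)$ and $\mathcal F_V\sim\mathcal G_V$ for all $V$ in this set. Causal teams: $(T^-,\mathcal F)\approx(S^-,\mathcal G)$ iff $\mathcal F\sim\mathcal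 G$ and $T^-=S^-$. Generalized causal teams: for $\mathcal F\in\mathbb F_\sigma$ let $T^{\mathcal F}=\{(s,\mathcal G)\in T\mid\mathcal G\sim\mathcal F\}$; $S\approx T$ iff $(S^{\mathcal F})^-=(T^{\mathcal F})^-$ for all $\mathcal F\in\mathbb F_\sigma$. -}

module Defs where

open import Data.Nat using (ℕ; zero; suc; _<_)
open import Data.Fin using (Fin; _≟_)
open import Data.Bool using (Bool; true; false; _∧_; not; if_then_else_)
open import Data.Maybe using (Maybe; just; nothing; is-just; fromMaybe)
open import Data.List using (List; []; _∷_; [_]; _++_; map)
open import Data.List.Relation.Unary.All using (All)
open import Data.List.Relation.Unary.Any using (Any)
open import Data.List.Membership.Propositional using (_∈_)
open import Data.Product using (Σ; _×_; _,_; proj₁; proj₂)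
open import Data.Sum using (_⊎_)
open import Relation.Nullary using (¬_; yes; no)
open import Relation.Binary.PropositionalEquality using (_≡_; refl)
open import Relation.Binary.Construct.Closure.Transitive using (TransClosure)
open import Function.Bundles using (_⇔_)

-- A signature: Dom = Fin n (nonempty), Ran(X) = Fin (rng X) (nonempty).
record Signature : Set where
  field
    n     : ℕ
    n>0   : 0 < n
    rng   : Fin n → ℕ
    rng>0 : ∀ X → 0 < rng X

-- Language fragments: pure CO, CO with ⊔, CO with dependence atoms.
data Kind : Set where
  co sq dp : Kind

∧-trueˡ : ∀ {b c} → b ∧ c ≡ true → b ≡ true
∧-trueˡ {true} _ = refl

iter : {A : Set} → ℕ → (A → A) → A → A
iter zero    f a = a
iter (suc k) f a = f (iter k f a)

module Sig (σ : Signature) where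
  open Signature σ

  Var : Set
  Var = Fin n

  Val : Var → Set
  Val X = Fin (rng X)

  Asg : Set
  Asg = (X : Var) → Val X

  _≗ₐ_ : Asg → Asg → Set
  s ≗ₐ t = ∀ X → s X ≡ t X

  AgreeOn : (Var → Bool) → Asg → Asg → Set
  AgreeOn P s t = ∀ X → P X ≡ true → s X ≡ t X

  -- En V ≡ true means V ∈ En(F);
  -- PA V X ≡ true means X ∈ PA_V.  F_V : Ran(PA_V) → Ran(V) is
  -- represented as a function on full assignments that depends only
  -- on the values of PA_V (fn-loc).  Components for V ∉ En(F) are
  -- irrelevant junk (ignored by _≃F_ below).
  record SysF : Set where
    field
      En     : Var → Bool
      PA     : Var → Var → Bool
      PA-irr : ∀ V → En V ≡ true → PA V V ≡ false
      fn     : (V : Var) → Asg → Val V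
      fn-loc : ∀ V s t → AgreeOn (PA V) s t → fn V s ≡ fn V t
  open SysF public

  _≃F_ : SysF → SysF → Set
  F ≃F G = (∀ V → En F V ≡ En G V)
         × (∀ V → En F V ≡ true → ∀ X → PA F V X ≡ PA G V X)
         × (∀ V → En F V ≡ true → ∀ s → fn F V s ≡ fn G V s)

  Edge : SysF → Var → Var → Set
  Edge F X Y = (En F Y ≡ true) × (PA F Y X ≡ true)

  Recursive : SysF → Set
  Recursive F = ∀ V → ¬ TransClosure (Edge F) V V

  Compatible : SysF → Asg → Set
  Compatible F s = ∀ V → En F V ≡ true → s V ≡ fn F V s

  Intv : Set
  Intv = List (Σ Var Val)

  Consistent : Intv → Set
  Consistent xs = ∀ X (x y : Val X) → (X , x) ∈ xs → (X , y) ∈ xs → x ≡ y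

  lookupI : Intv → (V : Var) → Maybe (Val V)
  lookupI [] V = nothing
  lookupI ((X , x) ∷ xs) V with X ≟ V
  ... | yes refl = just x
  ... | no _     = lookupI xs V

  inI : Intv → Var → Bool
  inI xs V = is-just (lookupI xs V)

  intvSys : SysF → Intv → SysF
  intvSys F xs = record
    { En     = λ V → En F V ∧ not (inI xs V)
    ; PA     = PA F
    ; PA-irr = λ V e → PA-irr F V (∧-trueˡ e)
    ; fn     = fn F
    ; fn-loc = fn-loc F }

  -- s_{X=x}: values x_i on X, s(V) outside En(F) ∪ X, and
  -- F_V(s_{X=x}(PA_V)) on En(F) ∖ X.  The recursive definition is
  -- computed by n rounds of fixed-point iteration, which (for a
  -- recursive F, whose causal paths have length < n) yields exactly
  -- the recursively defined assignment.
  intvAsg : SysF → Intv → Asg → Asg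
  intvAsg F xs s = iter n step base
    where
      base : Asg
      base V = fromMaybe (s V) (lookupI xs V)
      step : Asg → Asg
      step t V = if En (intvSys F xs) V then fn F V t else base V

  -- formulas: Fml co = CO[σ], Fml sq = CO_⊔[σ], Fml dp = COD[σ]
  infixr 6 _∧'_
  infixr 5 _∨'_ _⊔'_
  data Fml : Kind → Set where
    eq    : ∀ {k} (X : Var) → Val X → Fml k
    neg   : ∀ {k} → Fml co → Fml k
    _∧'_  : ∀ {k} → Fml k → Fml k → Fml k
    _∨'_  : ∀ {k} → Fml k → Fml k → Fml k
    _□→_  : ∀ {k} → Intv → Fml k → Fml k
    _⊔'_  : Fml sq → Fml sq → Fml sq
    dep   : List Var → Var → Fml dp

  -- causal team semantics (on a pair (T⁻ , F), T⁻ a finite set given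
  -- as a list, elements identified up to _≗ₐ_)
  _∈ₐ_ : Asg → List Asg → Set
  s ∈ₐ L = Any (s ≗ₐ_) L

  _⊆ₐ_ : List Asg → List Asg → Set
  L ⊆ₐ M = ∀ {s} → s ∈ₐ L → s ∈ₐ M

  _≐ₐ_ : List Asg → List Asg → Set
  L ≐ₐ M = L ⊆ₐ M × M ⊆ₐ L

  satC : ∀ {k} → SysF → List Asg → Fml k → Set
  satC F T (eq X x)  = All (λ s → s X ≡ x) T
  satC F T (neg α)   = All (λ s → ¬ satC F [ s ] α) T
  satC F T (φ ∧' ψ)  = satC F T φ × satC F T ψ
  satC F T (φ ∨' ψ)  = Σ (List Asg) λ T₁ → Σ (List Asg) λ T₂ →
                         (T₁ ⊆ₐ T) × (T₂ ⊆ₐ T) × ((T₁ ++ T₂) ≐ₐ T)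
                         × satC F T₁ φ × satC F T₂ ψ
  satC F T (xs □→ φ) = Consistent xs →
                         satC (intvSys F xs) (map (intvAsg F xs) T) φ
  satC F T (φ ⊔' ψ)  = satC F T φ ⊎ satC F T ψ
  satC F T (dep Xs Y) = All (λ s → All (λ s' →
                          All (λ X → s X ≡ s' X) Xs → s Y ≡ s' Y) T) T

  record CausalTeam : Set where
    field
      sys    : SysF
      recur  : Recursive sys
      team   : List Asg
      compat : All (Compatible sys) team
  open CausalTeam public

  _⊨ᶜ_ : ∀ {k} → CausalTeam → Fml k → Set
  T ⊨ᶜ φ = satC (sys T) (team T) φ

  -- generalized causal team semantics (finite sets of pairs (s , F),
  -- elements identified up to _≗ₐ_ and _≃F_)
  Pair : Set
  Pair = Asg × SysF

  _∈ₚ_ : Pair → List Pair → Set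
  p ∈ₚ L = Any (λ q → (proj₁ p ≗ₐ proj₁ q) × (proj₂ p ≃F proj₂ q)) L

  _⊆ₚ_ : List Pair → List Pair → Set
  L ⊆ₚ M = ∀ {p} → p ∈ₚ L → p ∈ₚ M

  _≐ₚ_ : List Pair → List Pair → Set
  L ≐ₚ M = L ⊆ₚ M × M ⊆ₚ L

  intvPair : Intv → Pair → Pair
  intvPair xs (s , F) = intvAsg F xs s , intvSys F xs

  satG : ∀ {k} → List Pair → Fml k → Set
  satG T (eq X x)  = All (λ p → proj₁ p X ≡ x) T
  satG T (neg α)   = All (λ p → ¬ satG [ p ] α) T
  satG T (φ ∧' ψ)  = satG T φ × satG T ψ
  satG T (φ ∨' ψ)  = Σ (List Pair) λ T₁ → Σ (List Pair) λ T₂ →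
                       ((T₁ ++ T₂) ≐ₚ T) × satG T₁ φ × satG T₂ ψ
  satG T (xs □→ φ) = Consistent xs → satG (map (intvPair xs) T) φ
  satG T (φ ⊔' ψ)  = satG T φ ⊎ satG T ψ
  satG T (dep Xs Y) = All (λ p → All (λ p' →
                        All (λ X → proj₁ p X ≡ proj₁ p' X) Xs
                        → proj₁ p Y ≡ proj₁ p' Y) T) T

  record GCausalTeam : Set where
    field
      gteam : List Pair
      wf    : All (λ p → Recursive (proj₂ p) × Compatible (proj₂ p) (proj₁ p)) gteam
  open GCausalTeam public

  _⊨ᵍ_ : ∀ {k} → GCausalTeam → Fml k → Set
  T ⊨ᵍ φ = satG (gteam T) φ

  Constant : SysF → Var → Set
  Constant F V = ∀ s t → fn F V s ≡ fn F V t

  NonConst : SysF → Var → Set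
  NonConst F V = (En F V ≡ true) × ¬ Constant F V

  -- F_V ∼ G_V : F_V(x y) = G_V(x z) for all x on PA^F_V ∩ PA^G_V,
  -- y on PA^F_V ∖ PA^G_V, z on PA^G_V ∖ PA^F_V
  _∼[_]_ : SysF → Var → SysF → Set
  F ∼[ V ] G = ∀ s t → AgreeOn (λ X → PA F V X ∧ PA G V X) s t
                     → fn F V s ≡ fn G V t

  _∼_ : SysF → SysF → Set
  F ∼ G = (∀ V → NonConst F V ⇔ NonConst G V)
        × (∀ V → NonConst F V → F ∼[ V ] G)

  _≈ᶜ_ : CausalTeam → CausalTeam → Set
  T ≈ᶜ S = (sys T ∼ sys S) × (team T ≐ₐ team S)

  -- (T^F)⁻ membership: s ∈ {s' | (s' , G) ∈ T, G ∼ F}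
  InRestr : SysF → List Pair → Asg → Set
  InRestr F T s = Any (λ q → (s ≗ₐ proj₁ q) × (proj₂ q ∼ F)) T

  _≈ᵍ_ : GCausalTeam → GCausalTeam → Set
  S ≈ᵍ T = ∀ (F : SysF) (s : Asg) → InRestr F (gteam S) s ⇔ InRestr F (gteam T) s

module Submission where

-- Under both semantics a formula only inspects an assignment s together with
-- the "update" map of its system F: V ↦ F_V(t) for endogenous V, and V ↦ s(V)
-- for exogenous V.  Call F and G *in agreement at s* when these update maps
-- coincide.
--
-- If F ∼ G and s is compatible with both, then F and G agree
--      at s: non-constant mechanisms coincide by definition of ∼, and the
--      remaining ones (absent or constant) just reproduce s.
--   2. Interventions.  Interventions of agreeing systems produce the same
--      assignment, and the intervened systems agree again at the result.
--   3. Transport.  Pairs (s , F) and (t , G) are *linked* when s = t and F, G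
--      agree at s.  By induction on formulas, satisfaction is preserved along
--      links: for causal teams between two presentations linked in both
--      directions, and for generalized teams downwards along a covering by
--      links (all these logics are downward closed).
--
-- The theorem follows since ≈ yields such links (by part 1).

open import Defs
open import Data.Bool using (true; false; _∧_; not; if_then_else_)
open import Data.Bool.Properties using (∧-idem)
open import Data.Fin using (_≟_)
open import Data.Maybe using (just; nothing; fromMaybe)
open import Data.Nat using (suc; _<_)
open import Data.List using (List; []; _∷_; [_]; _++_; map)
open import Data.List.Relation.Unary.All using (All; []; _∷_; tabulate; lookup)
import Data.List.Relation.Unary.All.Properties as Allₚ
import Data.List.Relation.Unary.All as All
open import Data.List.Relation.Unary.Any using (Any; here)
import Data.List.Relation.Unary.Any as Any
import Data.List.Relation.Unary.Any.Properties as Anyₚ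
open import Data.List.Membership.Propositional using (_∈_; find; lose)
open import Data.List.Relation.Binary.Permutation.Propositional using (_↭_; prep; ↭-sym; ↭-trans)
open import Data.List.Relation.Binary.Permutation.Propositional.Properties using (shift; Any-resp-↭)
open import Data.Product using (Σ; _×_; _,_; proj₁; proj₂)
open import Data.Sum using (_⊎_; inj₁; inj₂)
open import Function using (_∘_)
open import Function.Bundles using (_⇔_; mk⇔; Equivalence)
open import Relation.Nullary using (¬_; yes; no)
open import Relation.Nullary.Decidable using (decidable-stable; ¬¬-excluded-middle)
open import Relation.Binary.PropositionalEquality using (_≡_; refl; sym; trans; cong; module ≡-Reasoning)

if-∧-false : ∀ {A : Set} b {c} {x y : A} → c ≡ false → (if b ∧ c then x else y) ≡ y
if-∧-false false _    = refl
if-∧-false true  refl = refl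

if-∧-true : ∀ {A : Set} b {c} {x y : A} → c ≡ true → (if b ∧ c then x else y) ≡ (if b then x else y)
if-∧-true false _    = refl
if-∧-true true  refl = refl

iter-last : ∀ {A : Set} k → 0 < k → (f : A → A) (b : A) → Σ A λ a → iter k f b ≡ f a
iter-last (suc k) _ f b = iter k f b , refl

iter-cong : ∀ {A : Set} (R : A → A → Set) k {f g : A → A} {b c : A} →
            (∀ {a a'} → R a a' → R (f a) (g a')) → R b c → R (iter k f b) (iter k g c)
iter-cong R 0       step bc = bc
iter-cong R (suc k) step bc = step (iter-cong R k step bc)

Covered : ∀ {A B : Set} → (A → B → Set) → List A → List B → Set
Covered R M L = All (λ m → Any (R m) L) M

All-covered : ∀ {A B : Set} {R : A → B → Set} {P : A → Set} {Q : B → Set} {M L} →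
              (∀ {m l} → R m l → Q l → P m) → Covered R M L → All Q L → All P M
All-covered pull cov qL = All.map (λ rel → let (l , l∈L , r) = find rel in pull r (lookup qL l∈L)) cov

Covered-map : ∀ {A B A' B' : Set} {R : A → B → Set} {R' : A' → B' → Set} {f : A → A'} {g : B → B'} {M L} →
              (∀ {m l} → R m l → R' (f m) (g l)) → Covered R M L → Covered R' (map f M) (map g L)
Covered-map rel cov = Allₚ.map⁺ (All.map (λ r → Anyₚ.map⁺ (Any.map rel r)) cov)

Covered-trans : ∀ {A B C : Set} {R : A → B → Set} {R' : B → C → Set} {R'' : A → C → Set} {M L K} →
                (∀ {a b c} → R a b → R' b c → R'' a c) → Covered R M L → Covered R' L K → Covered R'' M K
Covered-trans comp cov cov' =
  All.map (λ rel → let (l , l∈L , r) = find rel in Any.map (comp r) (lookup cov' l∈L)) cov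

split-⊎ : ∀ {A : Set} {P Q : A → Set} {xs : List A} → All (λ x → P x ⊎ Q x) xs →
          Σ (List A) λ ys → Σ (List A) λ zs → All P ys × All Q zs × (ys ++ zs ↭ xs)
split-⊎ [] = [] , [] , [] , [] , _↭_.refl
split-⊎ {xs = x ∷ _} (inj₁ p ∷ rest) with split-⊎ rest
... | ys , zs , pys , qzs , perm = x ∷ ys , zs , p ∷ pys , qzs , prep x perm
split-⊎ {xs = x ∷ _} (inj₂ q ∷ rest) with split-⊎ rest
... | ys , zs , pys , qzs , perm = ys , x ∷ zs , pys , q ∷ qzs , ↭-trans (shift x ys zs) (prep x perm)

module Invariance (σ : Signature) where
  open Sig σ
  open Signature σ using (n; n>0)
  open Equivalence

  ≗-refl : ∀ {s} → s ≗ₐ s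
  ≗-refl _ = refl

  ≗-sym : ∀ {s t} → s ≗ₐ t → t ≗ₐ s
  ≗-sym e V = sym (e V)

  ≗-trans : ∀ {s t u} → s ≗ₐ t → t ≗ₐ u → s ≗ₐ u
  ≗-trans e e' V = trans (e V) (e' V)

  update : SysF → Asg → (V : Var) → Asg → Val V
  update F s V t = if En F V then fn F V t else s V

  update-cong : ∀ F {s s' t t'} V → s V ≡ s' V → t ≗ₐ t' → update F s V t ≡ update F s' V t'
  update-cong F {t = t} {t'} V e et with En F V
  ... | true  = fn-loc F V t t' (λ X _ → et X)
  ... | false = e

  record AgreeAt (F G : SysF) (s : Asg) (V : Var) : Set where
    constructor agreeAt
    field coincide : ∀ t → update F s V t ≡ update G s V t
  open AgreeAt

  Agree : SysF → SysF → Asg → Set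
  Agree F G s = ∀ V → AgreeAt F G s V

  agree-sym : ∀ {F G s} → Agree F G s → Agree G F s
  agree-sym a V = agreeAt λ t → sym (coincide (a V) t)

  agree-trans : ∀ {F G H s} → Agree F G s → Agree G H s → Agree F H s
  agree-trans a a' V = agreeAt λ t → trans (coincide (a V) t) (coincide (a' V) t)

  agreeAt-resp : ∀ {F G s u V} → u V ≡ s V → AgreeAt F G s V → AgreeAt F G u V
  agreeAt-resp {F} {G} {s} {u} {V} e (agreeAt a) =
    agreeAt λ t → trans (update-cong F {u} {s} V e ≗-refl) (trans (a t) (update-cong G {s} {u} V (sym e) ≗-refl))

  agree-resp : ∀ {F G s u} → u ≗ₐ s → Agree F G s → Agree F G u
  agree-resp e a V = agreeAt-resp (e V) (a V)

  agree-≃ : ∀ {F G s} → F ≃F G → Agree F G s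
  agree-≃ {F} {G} {s} (sameEn , _ , sameFn) V = agreeAt agreeV
    where
      agreeV : ∀ t → update F s V t ≡ update G s V t
      agreeV t with En F V in eF | En G V in eG | sameEn V
      ... | true  | true  | _ = sameFn V eF t
      ... | false | false | _ = refl
      ... | true  | false | ()
      ... | false | true  | ()

  inert : ∀ {F s V} → Compatible F s → ¬ NonConst F V → ∀ t → update F s V t ≡ s V
  inert {F} {s} {V} compat ¬nc t with En F V in e
  ... | false = refl
  ... | true  = decidable-stable (fn F V t ≟ s V)
                  λ ne → ¬nc (refl , λ const → ne (trans (const t s) (sym (compat V e))))

  active : ∀ {F s V} → NonConst F V → ∀ t → update F s V t ≡ fn F V t
  active {F} {V = V} (e , _) t with En F V | e
  ... | true | refl = refl

  agree-∼ : ∀ {F G s} → F ∼ G → Compatible F s → Compatible G s → Agree F G s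
  agree-∼ {F} {G} {s} (sameNC , sameFn) cF cG V = agreeAt λ t →
    decidable-stable (update F s V t ≟ update G s V t) λ ne → ¬¬-excluded-middle λ where
      (yes ncF) → ne (begin
        update F s V t  ≡⟨ active {F} {s} ncF t ⟩
        fn F V t        ≡⟨ sameFn V ncF t t (λ _ _ → refl) ⟩
        fn G V t        ≡⟨ sym (active {G} {s} (to (sameNC V) ncF) t) ⟩
        update G s V t  ∎)
      (no ¬ncF) → ne (trans (inert {F} cF ¬ncF t) (sym (inert {G} cG (λ ncG → ¬ncF (from (sameNC V) ncG)) t)))
    where open ≡-Reasoning

  agree-shift : ∀ {F G s u V t₀} → AgreeAt F G s V → u V ≡ update F s V t₀ → AgreeAt F G u V
  agree-shift {F} {G} {s} {u} {V} {t₀} (agreeAt a) = agreeAt ∘ shifted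
    where
      shifted : u V ≡ update F s V t₀ → ∀ t → update F u V t ≡ update G u V t
      shifted e t with En F V | En G V | a t | a t₀ | e
      ... | true  | true  | p | _ | _ = p
      ... | false | false | _ | _ | _ = refl
      ... | true  | false | p | q | r = trans p (sym (trans r q))
      ... | false | true  | p | _ | r = trans r p

  -- Part 2: interventions.  s_{X=x} iterates the update map of F_{X=x}
  -- starting from s[X ↦ x] (see intvAsg); base xs s is this starting point.
  base : Intv → Asg → Asg
  base xs s V = fromMaybe (s V) (lookupI xs V)

  base-cong : ∀ xs {s s'} → s ≗ₐ s' → base xs s ≗ₐ base xs s'
  base-cong xs e V with lookupI xs V
  ... | just _  = refl
  ... | nothing = e V

  base-unmasked : ∀ xs s {V} → inI xs V ≡ false → base xs s V ≡ s V
  base-unmasked xs s {V} nI with lookupI xs V | nI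
  ... | nothing | _ = refl

  update-unmasked : ∀ F xs {u V t} → inI xs V ≡ false → update (intvSys F xs) u V t ≡ update F u V t
  update-unmasked F xs {V = V} e = if-∧-true (En F V) (cong not e)

  agree-intvSys : ∀ {F G u} xs → (∀ V → inI xs V ≡ false → AgreeAt F G u V) →
                  Agree (intvSys F xs) (intvSys G xs) u
  agree-intvSys {F} {G} {u} xs a V = agreeAt agreeV
    where
      agreeV : ∀ t → update (intvSys F xs) u V t ≡ update (intvSys G xs) u V t
      agreeV t with inI xs V in e
      ... | true  = trans (if-∧-false (En F V) refl) (sym (if-∧-false (En G V) refl))
      ... | false = trans (if-∧-true (En F V) refl) (trans (coincide (a V e) t) (sym (if-∧-true (En G V) refl)))

  agree-base : ∀ {F G s} xs → Agree F G s → Agree (intvSys F xs) (intvSys G xs) (base xs s)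
  agree-base {s = s} xs a = agree-intvSys xs λ V nI → agreeAt-resp (base-unmasked xs s nI) (a V)

  intv-cong : ∀ {F G s s'} xs → Agree F G s → s ≗ₐ s' → intvAsg F xs s ≗ₐ intvAsg G xs s'
  intv-cong {G = G} {s} {s'} xs a e =
    iter-cong _≗ₐ_ n
      (λ et V → trans (coincide (agree-base xs a V) _)
                      (update-cong (intvSys G xs) {base xs s} {base xs s'} V (base-cong xs e V) et))
      (base-cong xs e)

  intv-unmasked : ∀ F xs s {V} → inI xs V ≡ false → Σ Asg λ t₀ → intvAsg F xs s V ≡ update F s V t₀
  intv-unmasked F xs s {V} nI with iter-last n n>0 (λ t V → update (intvSys F xs) (base xs s) V t) (base xs s)
  ... | t₀ , last = t₀ , (begin
    intvAsg F xs s V                         ≡⟨ cong (λ u → u V) last ⟩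
    update (intvSys F xs) (base xs s) V t₀   ≡⟨ update-unmasked F xs {base xs s} nI ⟩
    update F (base xs s) V t₀                ≡⟨ update-cong F {base xs s} {s} V (base-unmasked xs s nI) ≗-refl ⟩
    update F s V t₀                          ∎)
    where open ≡-Reasoning

  agree-intv : ∀ {F G s} xs → Agree F G s → Agree (intvSys F xs) (intvSys G xs) (intvAsg F xs s)
  agree-intv {F} {s = s} xs a = agree-intvSys xs λ V nI → agree-shift (a V) (proj₂ (intv-unmasked F xs s nI))

  record Linked (p q : Pair) : Set where
    constructor link
    field
      sameAsg : proj₁ p ≗ₐ proj₁ q
      agree   : Agree (proj₂ p) (proj₂ q) (proj₁ p)
  open Linked

  Linked-sym : ∀ {p q} → Linked p q → Linked q p
  Linked-sym (link e a) = link (≗-sym e) (agree-resp (≗-sym e) (agree-sym a))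

  Linked-trans : ∀ {p q r} → Linked p q → Linked q r → Linked p r
  Linked-trans (link e a) (link e' a') = link (≗-trans e e') (agree-trans a (agree-resp e a'))

  Linked-intv : ∀ xs {p q} → Linked p q → Linked (intvPair xs p) (intvPair xs q)
  Linked-intv xs (link e a) = link (intv-cong xs a e) (agree-intv xs a)

  compatible-resp : ∀ {F s t} → s ≗ₐ t → Compatible F t → Compatible F s
  compatible-resp {F} {s} {t} e c V eV = trans (e V) (trans (c V eV) (fn-loc F V t s (λ X _ → sym (e X))))

  Linked-∼ : ∀ {F G s t} → F ∼ G → Compatible F s → Compatible G t → s ≗ₐ t → Linked (s , F) (t , G)
  Linked-∼ {G = G} sim cF cG e = link e (agree-∼ sim cF (compatible-resp {G} e cG))

  Determines : List Var → Var → Asg → Asg → Set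
  Determines Xs Y a b = All (λ X → a X ≡ b X) Xs → a Y ≡ b Y

  Dep : {A : Set} → (A → Asg) → List Var → Var → List A → Set
  Dep val Xs Y L = All (λ p → All (λ p' → Determines Xs Y (val p) (val p')) L) L

  Determines-resp : ∀ {Xs Y a a' b b'} → a ≗ₐ a' → b ≗ₐ b' → Determines Xs Y a b → Determines Xs Y a' b'
  Determines-resp {Y = Y} ea eb det agreeXs =
    trans (sym (ea Y)) (trans (det (All.map (λ {X} e → trans (ea X) (trans e (sym (eb X)))) agreeXs)) (eb Y))

  Dep-covered : ∀ {A B : Set} {R : A → B → Set} (val : A → Asg) (val' : B → Asg) {Xs Y M L} →
                (∀ {m l} → R m l → val m ≗ₐ val' l) → Covered R M L → Dep val' Xs Y L → Dep val Xs Y M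
  Dep-covered val val' same cov depL =
    All-covered (λ r → All.map (Determines-resp (≗-sym (same r)) ≗-refl)) cov
      (All.map (All-covered (λ r → Determines-resp ≗-refl (≗-sym (same r))) cov) depL)

  Interchangeable : SysF → List Asg → SysF → List Asg → Set
  Interchangeable F L G M = Covered (λ s t → Linked (s , F) (t , G)) L M
                          × Covered (λ t s → Linked (t , G) (s , F)) M L

  ⊆ₐ-trans : ∀ {L M K} → L ⊆ₐ M → M ⊆ₐ K → L ⊆ₐ K
  ⊆ₐ-trans L⊆M M⊆K s∈L = M⊆K (L⊆M s∈L)

  covered-⊆ₐ : ∀ {F G L M} → Covered (λ s t → Linked (s , F) (t , G)) L M → L ⊆ₐ M
  covered-⊆ₐ cov s∈L = let (l , l∈L , e) = find s∈L in
                       Any.map (λ r → ≗-trans e (sameAsg r)) (lookup cov l∈L)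

  agree-member : ∀ {F G L M s} → Interchangeable F L G M → s ∈ₐ L → Agree F G s
  agree-member (cov , _) s∈L = let (l , l∈L , e) = find s∈L
                                   (_ , _ , r) = find (lookup cov l∈L) in agree-resp e (agree r)

  Interchangeable-⊆ : ∀ {F G L M T} → Interchangeable F L G M → T ⊆ₐ L → Interchangeable F T G T
  Interchangeable-⊆ {T = T} ic T⊆L =
      tabulate (λ t∈T → lose t∈T (link ≗-refl (agreeT t∈T)))
    , tabulate (λ t∈T → lose t∈T (link ≗-refl (agree-sym (agreeT t∈T))))
    where
      agreeT : ∀ {t} → t ∈ T → Agree _ _ t
      agreeT t∈T = agree-member ic (T⊆L (lose t∈T ≗-refl))

  transport-causal : ∀ {k} (φ : Fml k) {F G L M} → Interchangeable F L G M → satC F L φ → satC G M φ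
  transport-causal (eq X x) (_ , cov) h = All-covered (λ r p → trans (sameAsg r X) p) cov h
  transport-causal (neg α) (_ , cov) h = All-covered back cov h
    where
      back : ∀ {t s} → Linked (t , _) (s , _) → ¬ satC _ [ s ] α → ¬ satC _ [ t ] α
      back r ¬sat sat = ¬sat (transport-causal α ((here r ∷ []) , (here (Linked-sym r) ∷ [])) sat)
  transport-causal (φ ∧' ψ) ic (h₁ , h₂) = transport-causal φ ic h₁ , transport-causal ψ ic h₂
  transport-causal (φ ∨' ψ) ic@(cov , cov') (T₁ , T₂ , T₁⊆ , T₂⊆ , (⊆L , L⊆) , h₁ , h₂) =
      T₁ , T₂ , ⊆ₐ-trans T₁⊆ (covered-⊆ₐ cov) , ⊆ₐ-trans T₂⊆ (covered-⊆ₐ cov)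
    , (⊆ₐ-trans ⊆L (covered-⊆ₐ cov) , ⊆ₐ-trans (covered-⊆ₐ cov') L⊆)
    , transport-causal φ (Interchangeable-⊆ ic T₁⊆) h₁
    , transport-causal ψ (Interchangeable-⊆ ic T₂⊆) h₂
  transport-causal (xs □→ φ) (cov , cov') h c =
    transport-causal φ (Covered-map (Linked-intv xs) cov , Covered-map (Linked-intv xs) cov') (h c)
  transport-causal (φ ⊔' ψ) ic (inj₁ h) = inj₁ (transport-causal φ ic h)
  transport-causal (φ ⊔' ψ) ic (inj₂ h) = inj₂ (transport-causal ψ ic h)
  transport-causal (dep Xs Y) (_ , cov) h = Dep-covered (λ s → s) (λ s → s) sameAsg cov h

  Covers : List Pair → List Pair → Set
  Covers S T = Covered Linked S T

  ≃F-refl : ∀ F → F ≃F F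
  ≃F-refl F = (λ _ → refl) , (λ _ _ _ → refl) , (λ _ _ _ → refl)

  covers-⊆ₚ : ∀ {T T'} → T ⊆ₚ T' → Covers T T'
  covers-⊆ₚ T⊆ = tabulate λ {p} p∈T → Any.map equal⇒linked (T⊆ {p} (lose p∈T (≗-refl , ≃F-refl (proj₂ p))))
    where
      equal⇒linked : ∀ {p q} → (proj₁ p ≗ₐ proj₁ q) × (proj₂ p ≃F proj₂ q) → Linked p q
      equal⇒linked (e , same) = link e (agree-≃ same)

  split-covers : ∀ {S T₁ T₂} → Covers S (T₁ ++ T₂) →
                 Σ (List Pair) λ S₁ → Σ (List Pair) λ S₂ → Covers S₁ T₁ × Covers S₂ T₂ × ((S₁ ++ S₂) ≐ₚ S)
  split-covers {T₁ = T₁} cov with split-⊎ (All.map (Anyₚ.++⁻ T₁) cov)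
  ... | S₁ , S₂ , cov₁ , cov₂ , perm = S₁ , S₂ , cov₁ , cov₂ , (Any-resp-↭ perm , Any-resp-↭ (↭-sym perm))

  transport-general : ∀ {k} (φ : Fml k) {S T} → Covers S T → satG T φ → satG S φ
  transport-general (eq X x) cov h = All-covered (λ r p → trans (sameAsg r X) p) cov h
  transport-general (neg α) cov h =
    All-covered (λ r ¬sat sat → ¬sat (transport-general α (here (Linked-sym r) ∷ []) sat)) cov h
  transport-general (φ ∧' ψ) cov (h₁ , h₂) = transport-general φ cov h₁ , transport-general ψ cov h₂
  transport-general (φ ∨' ψ) cov (T₁ , T₂ , (_ , T⊆) , h₁ , h₂)
    with split-covers (Covered-trans Linked-trans cov (covers-⊆ₚ (λ {p} → T⊆ {p})))
  ... | S₁ , S₂ , cov₁ , cov₂ , same = S₁ , S₂ , same , transport-general φ cov₁ h₁ , transport-general ψ cov₂ h₂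
  transport-general (xs □→ φ) cov h c = transport-general φ (Covered-map (Linked-intv xs) cov) (h c)
  transport-general (φ ⊔' ψ) cov (inj₁ h) = inj₁ (transport-general φ cov h)
  transport-general (φ ⊔' ψ) cov (inj₂ h) = inj₂ (transport-general ψ cov h)
  transport-general (dep Xs Y) cov h = Dep-covered proj₁ proj₁ sameAsg cov h

  ∼-refl : ∀ F → F ∼ F
  ∼-refl F = (λ _ → mk⇔ (λ nc → nc) (λ nc → nc)) , λ V _ s t ag → fn-loc F V s t (λ X h → ag X (trans (∧-idem _) h))

  interchangeable-≈ᶜ : ∀ T S → T ≈ᶜ S → Interchangeable (sys T) (team T) (sys S) (team S)
  interchangeable-≈ᶜ T S (sim , T⊆S , S⊆T) =
    tabulate linkT , tabulate (λ s∈S → Any.map Linked-sym (linkS s∈S))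
    where
      linkT : ∀ {t} → t ∈ team T → Any (λ s → Linked (t , sys T) (s , sys S)) (team S)
      linkT t∈T = let (s , s∈S , e) = find (T⊆S (lose t∈T ≗-refl)) in
        lose s∈S (Linked-∼ sim (lookup (compat T) t∈T) (lookup (compat S) s∈S) e)
      linkS : ∀ {s} → s ∈ team S → Any (λ t → Linked (t , sys T) (s , sys S)) (team T)
      linkS s∈S = let (t , t∈T , e) = find (S⊆T (lose s∈S ≗-refl)) in
        lose t∈T (Linked-∼ sim (lookup (compat T) t∈T) (lookup (compat S) s∈S) (≗-sym e))

  covers-≈ᵍ : (T S : GCausalTeam) → (∀ F s → InRestr F (gteam S) s → InRestr F (gteam T) s) → Covers (gteam S) (gteam T)
  covers-≈ᵍ T S S⊆T = tabulate λ {q} q∈S →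
    let (p , p∈T , e , sim) = find (S⊆T (proj₂ q) (proj₁ q) (lose q∈S (≗-refl , ∼-refl (proj₂ q)))) in
    lose p∈T (Linked-sym (Linked-∼ sim (proj₂ (lookup (wf T) p∈T)) (proj₂ (lookup (wf S) q∈S)) (≗-sym e)))

  causal : ∀ {k} (φ : Fml k) (T S : CausalTeam) → T ≈ᶜ S → (T ⊨ᶜ φ ⇔ S ⊨ᶜ φ)
  causal φ T S T≈S = let (cov , cov') = interchangeable-≈ᶜ T S T≈S in
    mk⇔ (transport-causal φ (cov , cov')) (transport-causal φ (cov' , cov))

  general : ∀ {k} (φ : Fml k) (T S : GCausalTeam) → T ≈ᵍ S → (T ⊨ᵍ φ ⇔ S ⊨ᵍ φ)
  general φ T S T≈S = mk⇔ (transport-general φ (covers-≈ᵍ T S λ F s → from (T≈S F s)))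
                          (transport-general φ (covers-≈ᵍ S T λ F s → to (T≈S F s)))

theorem3p3 : (σ : Signature) → let open Sig σ in
    (∀ (φ : Fml sq) (T S : CausalTeam) → T ≈ᶜ S → (T ⊨ᶜ φ ⇔ S ⊨ᶜ φ))
    × (∀ (φ : Fml dp) (T S : CausalTeam) → T ≈ᶜ S → (T ⊨ᶜ φ ⇔ S ⊨ᶜ φ))
    × (∀ (φ : Fml sq) (T S : GCausalTeam) → T ≈ᵍ S → (T ⊨ᵍ φ ⇔ S ⊨ᵍ φ))
    × (∀ (φ : Fml dp) (T S : GCausalTeam) → T ≈ᵍ S → (T ⊨ᵍ φ ⇔ S ⊨ᵍ φ))
theorem3p3 σ = causal , causal , general , general
  where open Invariance σ
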